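{- Let $n>3$ be an integer with $n\equiv 0\pmod 3$. Then $Circ(2n,\{1,2\})$ admits a 2-B1F with types $\left([2n],[6^{2n/6}]\right)$, i.e. some pairs of 1-factors have as union a single cycle of length $2n$, the remaining pairs have as union $2n/6$ disjoint 6-cycles, and each of these two types occurs for the same number of pairs.
   Context: For a positive integer $N$ and $D\subseteq\{1,\dots,\lfloor N/2\rfloor\}$, the circulant graph $Circ(N,D)$ has vertex set $\mathbb{Z}_N$, with $u,v$ adjacent iff $u-v\equiv \pm d \pmod N$ for some $d\in D$. A 1-factor of a graph is a 1-regular spanning subgraph; a 1-factorisation is a partition of the edge set into 1-factors. For two 1-factors of a 1-factorisation, their union is a disjoint union of cycles; the pair has type $[c_1,\dots,c_t]$ (a multiset) if the union consists of $t$ cycles of lengths $c_1,\dots,c_t$; $[c^k]$ denotes $k$ cycles of length $c$. If $T_1,\dots,T_m$ are the distinct types occurring among all unordered pairs of distinct 1-factors of a 1-factorisation $\mathcal{F}$, and each $T_i$ occurs for the same number of pairs, then $\mathcal{F}$ is an $m$-balanced 1-factorisation ($m$-B1F) with types $(T_1,\dots,T_m)$. -}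

module Defs where

open import Data.Nat using (ℕ; zero; suc; _<_)
open import Data.Fin using (Fin; toℕ)
open import Data.Integer using (ℤ; +_; _-_; _+_)
open import Data.Integer.Divisibility using (_∣_)
open import Data.List using (List; length; allFin; filter; _++_; map; concatMap)
open import Data.List.Membership.Propositional using (_∈_)
open import Data.List.Relation.Unary.Unique.Propositional using (Unique)
open import Data.Product using (Σ; ∃; _×_; _,_)
open import Data.Sum using (_⊎_)
open import Data.Bool using (Bool; true; false)
open import Relation.Binary.PropositionalEquality using (_≡_)
open import Relation.Nullary.Decidable using (does)
open import Data.Nat using (_<?_)
open import Function.Bundles using (_⇔_)

CircAdj : (N : ℕ) → List ℕ → Fin N → Fin N → Set
CircAdj N D u v =
  Σ ℕ λ d → d ∈ D ×
    ((+ N ∣ ((+ toℕ u - + toℕ v) - + d)) ⊎ (+ N ∣ ((+ toℕ u - + toℕ v) + + d)))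

-- A 1-factor (perfect matching, i.e. 1-regular spanning subgraph) of Circ(N,D),
-- given by its partner function: the edges are {u , f u}.
record OneFactor (N : ℕ) (D : List ℕ) : Set where
  field
    mate     : Fin N → Fin N
    mate-adj : ∀ u → CircAdj N D u (mate u)
    mate-inv : ∀ u → mate (mate u) ≡ u
open OneFactor public

record OneFactorisation (N : ℕ) (D : List ℕ) : Set where
  field
    k       : ℕ
    factor  : Fin k → OneFactor N D
    covers  : ∀ u v → CircAdj N D u v → Σ (Fin k) λ i → mate (factor i) u ≡ v
    unique  : ∀ u v (i j : Fin k) →
              mate (factor i) u ≡ v → mate (factor j) u ≡ v → i ≡ j
open OneFactorisation public

data Reach {N : ℕ} {D : List ℕ} (F G : OneFactor N D) (u : Fin N) : Fin N → Set where
  here  : Reach F G u u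
  stepF : ∀ {v} → Reach F G u v → Reach F G u (mate F v)
  stepG : ∀ {v} → Reach F G u v → Reach F G u (mate G v)

-- The connected component of u in F ∪ G has exactly c vertices
-- (for two edge-disjoint 1-factors this component is a cycle of length c).
ComponentSize : {N : ℕ} {D : List ℕ} → OneFactor N D → OneFactor N D → Fin N → ℕ → Set
ComponentSize {N} F G u c =
  Σ (List (Fin N)) λ xs → Unique xs × length xs ≡ c × (∀ v → (v ∈ xs) ⇔ Reach F G u v)

-- The pair {F, G} has type [c^(N/c)]: the union consists of disjoint cycles
-- all of length c (equivalently, every component has exactly c vertices).
HasTypeUniform : {N : ℕ} {D : List ℕ} → OneFactor N D → OneFactor N D → ℕ → Set
HasTypeUniform {N} F G c = ∀ u → ComponentSize F G u c

-- Unordered pairs {i, j} of distinct indices, as ordered pairs with i < j.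
pairs : (k : ℕ) → List (Fin k × Fin k)
pairs k = concatMap (λ i → map (λ j → (i , j)) (filter (λ j → toℕ i <? toℕ j) (allFin k))) (allFin k)

countClass : {k : ℕ} → (Fin k → Fin k → Bool) → Bool → ℕ
countClass {k} cls b = length (filter (λ p → eqB (cls (Data.Product.proj₁ p) (Data.Product.proj₂ p)) b) (pairs k))
  where
  open import Relation.Nullary using (Dec)
  open import Data.Bool.Properties using () renaming (_≟_ to _≟B_)
  eqB : (x y : Bool) → Dec (x ≡ y)
  eqB = _≟B_

Is2B1F-Uniform : {N : ℕ} {D : List ℕ} → OneFactorisation N D → ℕ → ℕ → Set
Is2B1F-Uniform ℱ c₁ c₂ =
  Σ (Fin (k ℱ) → Fin (k ℱ) → Bool) λ cls →
    (∀ i j → toℕ i < toℕ j →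
        (cls i j ≡ true  → HasTypeUniform (factor ℱ i) (factor ℱ j) c₁) ×
        (cls i j ≡ false → HasTypeUniform (factor ℱ i) (factor ℱ j) c₂))
    × countClass cls true ≡ countClass cls false
    × 0 < countClass cls true

module Submission where

-- Write 2n = 6m and view ℤ_(6m) as m blocks of six consecutive vertices.  Each of the four
-- 1-factors is 6-periodic: the partner of u is u + δᵢ(u mod 6) with δᵢ(r) ∈ {±1, ±2}.  Along a
-- walk alternating between two factors, the residues visited and the total displacement depend
-- only on the starting residue, so each union Fᵢ ∪ Fⱼ is settled by a finite computation on
-- residues.  For the three pairs containing F₀, six alternating steps advance by exactly one
-- block while meeting every residue of the block, so the union is connected: a Hamiltonian
-- cycle.  For the other three pairs, six alternating steps return to the start through six
-- distinct residues, so the union is a disjoint union of hexagons.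

open import Defs
open import Data.Nat as ℕ using (ℕ; zero; suc)
import Data.Nat.Properties as ℕ
open import Data.Fin using (Fin; zero; suc; toℕ; inject₁)
open import Data.List using (List; _∷_; []; length; allFin)
open import Data.List.Properties using (length-tabulate)
open import Data.List.Relation.Unary.Any using (here; there)
open import Data.List.Membership.Propositional using (_∈_)
open import Data.List.Membership.Propositional.Properties using (∈-allFin)
open import Data.List.Relation.Unary.Unique.Propositional using (Unique)
open import Data.List.Relation.Unary.Unique.Propositional.Properties using (allFin⁺)
open import Data.Product using (Σ; ∃; _×_; _,_; proj₁; proj₂)
open import Function using (_∘_; id)
open import Function.Bundles using (mk⇔)
open import Relation.Binary.PropositionalEquality

pattern at₀ p = here p
pattern at₁ p = there (at₀ p)
pattern at₂ p = there (at₁ p)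
pattern at₃ p = there (at₂ p)
pattern at₄ p = there (at₃ p)
pattern at₅ p = there (at₄ p)

module _ {N : ℕ} {D : List ℕ} (F G : OneFactor N D) where

  Reach-trans : ∀ {u v w} → Reach F G u v → Reach F G v w → Reach F G u w
  Reach-trans p here      = p
  Reach-trans p (stepF q) = stepF (Reach-trans p q)
  Reach-trans p (stepG q) = stepG (Reach-trans p q)

  Reach-sym : ∀ {u v} → Reach F G u v → Reach F G v u
  Reach-sym here          = here
  Reach-sym (stepF {v} p) = Reach-trans (subst (Reach F G _) (mate-inv F v) (stepF here)) (Reach-sym p)
  Reach-sym (stepG {v} p) = Reach-trans (subst (Reach F G _) (mate-inv G v) (stepG here)) (Reach-sym p)

  closed-component : ∀ {u} xs → Unique xs → u ∈ xs →
                     (∀ {v} → v ∈ xs → mate F v ∈ xs) → (∀ {v} → v ∈ xs → mate G v ∈ xs) →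
                     (∀ {v} → v ∈ xs → Reach F G u v) → ComponentSize F G u (length xs)
  closed-component {u} xs distinct u∈xs closedF closedG reach = xs , distinct , refl , λ v → mk⇔ reach confined
    where
    confined : ∀ {v} → Reach F G u v → v ∈ xs
    confined here      = u∈xs
    confined (stepF p) = closedF (confined p)
    confined (stepG p) = closedG (confined p)

  hamiltonian : (∀ u v → Reach F G u v) → HasTypeUniform F G N
  hamiltonian connected u = subst (ComponentSize F G u) (length-tabulate id)
    (closed-component (allFin N) (allFin⁺ N) (∈-allFin u) (λ _ → ∈-allFin _) (λ _ → ∈-allFin _)
      (λ {v} _ → connected u v))

  hexagon : ∀ {u} z₁ z₂ z₃ z₄ z₅ →
            mate F u ≡ z₁ → mate G z₁ ≡ z₂ → mate F z₂ ≡ z₃ →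
            mate G z₃ ≡ z₄ → mate F z₄ ≡ z₅ → mate G z₅ ≡ u →
            Unique (u ∷ z₁ ∷ z₂ ∷ z₃ ∷ z₄ ∷ z₅ ∷ []) → ComponentSize F G u 6
  hexagon {u} _ _ _ _ _ refl refl refl refl refl closes distinct =
    closed-component xs distinct (here refl) closedF closedG reach
    where
    z₁ = mate F u
    z₂ = mate G z₁
    z₃ = mate F z₂
    z₄ = mate G z₃
    z₅ = mate F z₄
    xs = u ∷ z₁ ∷ z₂ ∷ z₃ ∷ z₄ ∷ z₅ ∷ []
    closedF : ∀ {v} → v ∈ xs → mate F v ∈ xs
    closedF (at₀ refl) = at₁ refl
    closedF (at₁ refl) = at₀ (mate-inv F u)
    closedF (at₂ refl) = at₃ refl
    closedF (at₃ refl) = at₂ (mate-inv F z₂)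
    closedF (at₄ refl) = at₅ refl
    closedF (at₅ refl) = at₄ (mate-inv F z₄)
    closedG : ∀ {v} → v ∈ xs → mate G v ∈ xs
    closedG (at₀ refl) = at₅ (trans (cong (mate G) (sym closes)) (mate-inv G z₅))
    closedG (at₁ refl) = at₂ refl
    closedG (at₂ refl) = at₁ (mate-inv G z₁)
    closedG (at₃ refl) = at₄ refl
    closedG (at₄ refl) = at₃ (mate-inv G z₃)
    closedG (at₅ refl) = at₀ closes
    reach : ∀ {v} → v ∈ xs → Reach F G u v
    reach (at₀ refl) = here
    reach (at₁ refl) = stepF here
    reach (at₂ refl) = stepG (stepF here)
    reach (at₃ refl) = stepF (stepG (stepF here))
    reach (at₄ refl) = stepG (stepF (stepG (stepF here)))
    reach (at₅ refl) = stepF (stepG (stepF (stepG (stepF here))))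

Reach-swap : ∀ {N D} {F G : OneFactor N D} {u v} → Reach F G u v → Reach G F u v
Reach-swap here      = here
Reach-swap (stepF p) = stepG (Reach-swap p)
Reach-swap (stepG p) = stepF (Reach-swap p)

module Congruence where

  open import Data.Nat.DivMod using (_%_; _/_)
  import Data.Nat.DivMod as ℕ
  import Data.Nat.Divisibility as ℕ
  open import Data.Integer as ℤ using (ℤ; +_; -_; _+_; _-_; _*_; 0ℤ; ∣_∣; _⊖_)
  import Data.Integer.Properties as ℤ
  import Data.Integer.Divisibility as Unsigned
  open import Data.Integer.Divisibility.Signed using (_∣_; divides; ∣ᵤ⇒∣; ∣⇒∣ᵤ; ∣m∣n⇒∣m+n; ∣m⇒∣-m)
  open import Data.Integer.Tactic.RingSolver using (solve-∀)
  import Data.Fin.Properties as Fin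
  open import Data.Sum as Sum using (_⊎_; inj₁; inj₂)
  open import Relation.Nullary using (contradiction)

  swap-last : ∀ a b c → (a + c) - b ≡ (a - b) + c
  swap-last = solve-∀

  infix 4 _≡_mod_

  -- _≡_mod_ and Shift are records rather than abbreviations so that their indices
  -- can be recovered by unification.
  record _≡_mod_ (a b : ℤ) (N : ℕ) : Set where
    constructor congruent
    field N∣a-b : + N ∣ a - b

  ∣∸⇒≡ : ∀ {N a b} → a ℕ.≤ b → b ℕ.< N → N ℕ.∣ b ℕ.∸ a → a ≡ b
  ∣∸⇒≡ {N} {a} {b} a≤b b<N N∣b∸a with b ℕ.∸ a in b∸a≡k
  ... | zero  = ℕ.≤-antisym a≤b (ℕ.m∸n≡0⇒m≤n b∸a≡k)
  ... | suc k = contradiction N∣b∸a (ℕ.>⇒∤ (ℕ.≤-<-trans b∸a≤b b<N))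
    where
    b∸a≤b : suc k ℕ.≤ b
    b∸a≤b = subst (ℕ._≤ b) b∸a≡k (ℕ.m∸n≤m b a)

  ∣⊖∣⇒≡ : ∀ {N a b} → a ℕ.< N → b ℕ.< N → N ℕ.∣ ∣ a ⊖ b ∣ → a ≡ b
  ∣⊖∣⇒≡ {N} {a} {b} a<N b<N N∣a⊖b with ℕ.≤-total a b
  ... | inj₁ a≤b = ∣∸⇒≡ a≤b b<N (subst (N ℕ.∣_) (ℤ.∣⊖∣-≤ a≤b) N∣a⊖b)
  ... | inj₂ b≤a =
    sym (∣∸⇒≡ b≤a a<N (subst (N ℕ.∣_) (trans (ℤ.∣m⊖n∣≡∣n⊖m∣ a b) (ℤ.∣⊖∣-≤ b≤a)) N∣a⊖b))

  module _ {N : ℕ} where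

    ≡-mod-reflexive : ∀ {a b} → a ≡ b → a ≡ b mod N
    ≡-mod-reflexive {a} refl = congruent (divides 0ℤ (ℤ.+-inverseʳ a))

    ≡-mod-trans : ∀ {a b c} → a ≡ b mod N → b ≡ c mod N → a ≡ c mod N
    ≡-mod-trans {a} {b} {c} (congruent p) (congruent q) =
      congruent (subst (+ N ∣_) (telescope a b c) (∣m∣n⇒∣m+n p q))
      where
      telescope : ∀ a b c → (a - b) + (b - c) ≡ a - c
      telescope = solve-∀

    ≡-mod-sym : ∀ {a b} → a ≡ b mod N → b ≡ a mod N
    ≡-mod-sym {a} {b} (congruent p) = congruent (subst (+ N ∣_) (neg-diff a b) (∣m⇒∣-m p))
      where
      neg-diff : ∀ a b → - (a - b) ≡ b - a
      neg-diff = solve-∀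

    +-congʳ-mod : ∀ {a b} c → a ≡ b mod N → a + c ≡ b + c mod N
    +-congʳ-mod {a} {b} c (congruent p) = congruent (subst (+ N ∣_) (shift-diff a b c) p)
      where
      shift-diff : ∀ a b c → a - b ≡ (a + c) - (b + c)
      shift-diff = solve-∀

    +-congˡ-mod : ∀ {a b} c → a ≡ b mod N → c + a ≡ c + b mod N
    +-congˡ-mod {a} {b} c (congruent p) = congruent (subst (+ N ∣_) (shift-diff a b c) p)
      where
      shift-diff : ∀ a b c → a - b ≡ (c + a) - (c + b)
      shift-diff = solve-∀

    toℕ-mod-injective : ∀ {u v : Fin N} → + toℕ u ≡ + toℕ v mod N → u ≡ v
    toℕ-mod-injective {u} {v} (congruent p) =
      Fin.toℕ-injective (∣⊖∣⇒≡ (Fin.toℕ<n u) (Fin.toℕ<n v) N∣u⊖v)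
      where
      N∣u⊖v : N ℕ.∣ ∣ toℕ u ⊖ toℕ v ∣
      N∣u⊖v = subst (λ z → N ℕ.∣ ∣ z ∣) (ℤ.m-n≡m⊖n (toℕ u) (toℕ v)) (∣⇒∣ᵤ p)

    record Shift (z : ℤ) (u v : Fin N) : Set where
      constructor shift
      field congruence : + toℕ u + z ≡ + toℕ v mod N

    shift-exact : ∀ {z u v} → + toℕ u + z ≡ + toℕ v → Shift z u v
    shift-exact eq = shift (≡-mod-reflexive eq)

    shift-zero : ∀ {u} → Shift 0ℤ u u
    shift-zero {u} = shift-exact (ℤ.+-identityʳ (+ toℕ u))

    shift-trans : ∀ {a b u v w} → Shift a u v → Shift b v w → Shift (a + b) u w
    shift-trans {a} {b} {u} (shift p) (shift q) = shift (≡-mod-trans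
      (subst (λ x → x ≡ _ mod N) (ℤ.+-assoc (+ toℕ u) a b) (+-congʳ-mod b p)) q)

    shift-cong : ∀ {a b u v} → a ≡ b mod N → Shift a u v → Shift b u v
    shift-cong {u = u} a≡b (shift p) = shift (≡-mod-trans (+-congˡ-mod (+ toℕ u) (≡-mod-sym a≡b)) p)

    shift-functional : ∀ {z u v w} → Shift z u v → Shift z u w → v ≡ w
    shift-functional (shift p) (shift q) = toℕ-mod-injective (≡-mod-trans (≡-mod-sym p) q)

    ∣⇒shift : ∀ {z u v} → + N Unsigned.∣ (+ toℕ u - + toℕ v) + z → Shift z u v
    ∣⇒shift {z} {u} {v} =
      shift ∘ congruent ∘ subst (+ N ∣_) (sym (swap-last (+ toℕ u) (+ toℕ v) z)) ∘ ∣ᵤ⇒∣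

    shift⇒∣ : ∀ {z u v} → Shift z u v → + N Unsigned.∣ (+ toℕ u - + toℕ v) + z
    shift⇒∣ {z} {u} {v} (shift (congruent p)) = ∣⇒∣ᵤ (subst (+ N ∣_) (swap-last (+ toℕ u) (+ toℕ v) z) p)

    circAdj⇒shift : ∀ {D u v} → CircAdj N D u v → ∃ λ d → d ∈ D × (Shift (- + d) u v ⊎ Shift (+ d) u v)
    circAdj⇒shift (d , d∈D , adj) = d , d∈D , Sum.map ∣⇒shift ∣⇒shift adj

    shift⇒circAdj : ∀ {D d u v} → d ∈ D → Shift (- + d) u v ⊎ Shift (+ d) u v → CircAdj N D u v
    shift⇒circAdj {d = d} d∈D s = d , d∈D , Sum.map shift⇒∣ shift⇒∣ s

  rotate : ∀ {k} → ℕ → Fin (suc k) → Fin (suc k)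
  rotate {k} d i = (toℕ i ℕ.+ d) ℕ.mod suc k

  rotate-shift : ∀ {k} d (i : Fin (suc k)) → Shift (+ d) i (rotate d i)
  rotate-shift {k} d i = shift (congruent (divides (+ (a / n)) (begin
      + a - + toℕ (rotate d i)                   ≡⟨ cong (λ t → + a - + t) (Fin.toℕ-fromℕ< (ℕ.m%n<n a n)) ⟩
      + a - + (a % n)                             ≡⟨ cong (λ t → + t - + (a % n)) (ℕ.m≡m%n+[m/n]*n a n) ⟩
      (+ (a % n) + + (a / n ℕ.* n)) - + (a % n)   ≡⟨ cancel (+ (a % n)) _ ⟩
      + (a / n ℕ.* n)                             ≡⟨ ℤ.pos-* (a / n) n ⟩
      + (a / n) * + n                             ∎)))
    where
    open ≡-Reasoning
    n = suc k
    a = toℕ i ℕ.+ d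
    cancel : ∀ x y → (x + y) - x ≡ y
    cancel = solve-∀

module Blocks (m′ n′ : ℕ) where

  open Congruence
  open import Data.Integer as ℤ using (ℤ; +_; -[1+_]; _+_; _-_; _*_; 0ℤ; 1ℤ; -1ℤ)
  import Data.Integer.Properties as ℤ
  open import Data.Integer.Divisibility.Signed using (divides)
  open import Data.Integer.Tactic.RingSolver using (solve-∀)
  open import Data.Fin using (combine; remQuot; fromℕ; fromℕ<)
  import Data.Fin.Properties as Fin
  open import Data.Fin.Induction using (<-weakInduction)
  open import Relation.Nullary using (yes; no)

  m n : ℕ
  m = suc m′
  n = suc n′

  -- The pair (q , r) stands for the vertex n q + r: block q, residue r.
  V : Set
  V = Fin m × Fin n

  φ : V → Fin (m ℕ.* n)
  φ (q , r) = combine q r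

  ψ : Fin (m ℕ.* n) → V
  ψ = remQuot n

  residue : Fin (m ℕ.* n) → Fin n
  residue u = proj₂ (ψ u)

  φ-ψ : ∀ u → φ (ψ u) ≡ u
  φ-ψ = Fin.combine-remQuot n

  ψ-φ : ∀ x → ψ (φ x) ≡ x
  ψ-φ (q , r) = Fin.remQuot-combine q r

  φ-injective : ∀ {x y} → φ x ≡ φ y → x ≡ y
  φ-injective {x} {y} eq = trans (sym (ψ-φ x)) (trans (cong ψ eq) (ψ-φ y))

  +toℕ-φ : ∀ q r → + toℕ (φ (q , r)) ≡ + n * + toℕ q + + toℕ r
  +toℕ-φ q r = trans (cong +_ (Fin.toℕ-combine q r)) (cong (_+ + toℕ r) (ℤ.pos-* n (toℕ q)))

  block-shift : ∀ {c z} (q q′ : Fin m) (r r′ : Fin n) →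
                Shift c q q′ → + toℕ r + z ≡ + toℕ r′ + c * + n → Shift z (φ (q , r)) (φ (q′ , r′))
  block-shift {c} {z} q q′ r r′ (shift (congruent (divides k q+c-q′≡km))) carry =
    shift (congruent (divides k (begin
      (+ toℕ (φ (q , r)) + z) - + toℕ (φ (q′ , r′))
        ≡⟨ cong₂ (λ a b → (a + z) - b) (+toℕ-φ q r) (+toℕ-φ q′ r′) ⟩
      (+ n * Q + R + z) - (+ n * Q′ + R′)     ≡⟨ regroup (+ n * Q) R z _ ⟩
      (+ n * Q + (R + z)) - (+ n * Q′ + R′)   ≡⟨ cong (λ t → (+ n * Q + t) - (+ n * Q′ + R′)) carry ⟩
      (+ n * Q + (R′ + c * + n)) - (+ n * Q′ + R′) ≡⟨ collect Q Q′ R′ c (+ n) ⟩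
      ((Q + c) - Q′) * + n                     ≡⟨ cong (_* + n) q+c-q′≡km ⟩
      (k * + m) * + n                          ≡⟨ ℤ.*-assoc k (+ m) (+ n) ⟩
      k * (+ m * + n)                          ≡⟨ cong (k *_) (sym (ℤ.pos-* m n)) ⟩
      k * + (m ℕ.* n)                          ∎)))
    where
    open ≡-Reasoning
    Q = + toℕ q
    Q′ = + toℕ q′
    R = + toℕ r
    R′ = + toℕ r′
    regroup : ∀ a b c d → (a + b + c) - d ≡ (a + (b + c)) - d
    regroup = solve-∀
    collect : ∀ q q′ r′ c n → (n * q + (r′ + c * n)) - (n * q′ + r′) ≡ ((q + c) - q′) * n
    collect = solve-∀

  next : V → V
  next (q , r) with toℕ r ℕ.<? n′
  ... | yes r<n′ = q , fromℕ< (ℕ.s≤s r<n′)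
  ... | no  _    = rotate 1 q , zero

  prev : V → V
  prev (q , zero)  = rotate m′ q , fromℕ n′
  prev (q , suc r) = q , inject₁ r

  next-shift : ∀ x → Shift 1ℤ (φ x) (φ (next x))
  next-shift (q , r) with toℕ r ℕ.<? n′
  ... | yes r<n′ = block-shift q q r _ shift-zero (begin
    + toℕ r + 1ℤ                    ≡⟨ carry (+ toℕ r) (+ n) ⟩
    + suc (toℕ r) + 0ℤ * + n        ≡⟨ cong (λ t → + t + 0ℤ * + n) (Fin.toℕ-fromℕ< (ℕ.s≤s r<n′)) ⟨
    + toℕ (fromℕ< (ℕ.s≤s r<n′)) + 0ℤ * + n ∎)
    where
    open ≡-Reasoning
    carry : ∀ r n → r + 1ℤ ≡ (1ℤ + r) + 0ℤ * n
    carry = solve-∀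
  ... | no r≮n′ = block-shift q _ r zero (rotate-shift 1 q) (begin
    + toℕ r + 1ℤ                    ≡⟨ cong (λ t → + t + 1ℤ) r≡n′ ⟩
    + n′ + 1ℤ                       ≡⟨ carry (+ n′) ⟩
    0ℤ + 1ℤ * + n                   ∎)
    where
    open ≡-Reasoning
    r≡n′ : toℕ r ≡ n′
    r≡n′ = ℕ.≤-antisym (Fin.toℕ≤pred[n] r) (ℕ.≮⇒≥ r≮n′)
    carry : ∀ r → r + 1ℤ ≡ 0ℤ + 1ℤ * (1ℤ + r)
    carry = solve-∀

  prev-shift : ∀ x → Shift -1ℤ (φ x) (φ (prev x))
  prev-shift (q , zero) = block-shift q _ zero _ (shift-cong m′≡-1 (rotate-shift m′ q)) (begin
    0ℤ + -1ℤ                        ≡⟨ carry (+ n′) ⟩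
    + n′ + -1ℤ * + n                ≡⟨ cong (λ t → + t + -1ℤ * + n) (Fin.toℕ-fromℕ n′) ⟨
    + toℕ (fromℕ n′) + -1ℤ * + n    ∎)
    where
    open ≡-Reasoning
    m′≡-1 : + m′ ≡ -1ℤ mod m
    m′≡-1 = congruent (divides 1ℤ (wrap (+ m′)))
      where
      wrap : ∀ m′ → m′ - -1ℤ ≡ 1ℤ * (1ℤ + m′)
      wrap = solve-∀
    carry : ∀ r → 0ℤ + -1ℤ ≡ r + -1ℤ * (1ℤ + r)
    carry = solve-∀
  prev-shift (q , suc r) = block-shift q q (suc r) _ shift-zero (begin
    + suc (toℕ r) + -1ℤ             ≡⟨ carry (+ toℕ r) (+ n) ⟩
    + toℕ r + 0ℤ * + n              ≡⟨ cong (λ t → + t + 0ℤ * + n) (Fin.toℕ-inject₁ r) ⟨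
    + toℕ (inject₁ r) + 0ℤ * + n    ∎)
    where
    open ≡-Reasoning
    carry : ∀ r n → (1ℤ + r) + -1ℤ ≡ r + 0ℤ * n
    carry = solve-∀

  move : ℤ → V → V
  move (+ zero)      x = x
  move (+ suc k)     x = move (+ k) (next x)
  move -[1+ zero ]   x = prev x
  move -[1+ suc k ]  x = move -[1+ k ] (prev x)

  move-shift : ∀ z x → Shift z (φ x) (φ (move z x))
  move-shift (+ zero)     x = shift-zero
  move-shift (+ suc k)    x = shift-trans (next-shift x) (move-shift (+ k) (next x))
  move-shift -[1+ zero ]  x = prev-shift x
  move-shift -[1+ suc k ] x = shift-trans (prev-shift x) (move-shift -[1+ k ] (prev x))

  nextᵣ : Fin n → Fin n
  nextᵣ r with toℕ r ℕ.<? n′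
  ... | yes r<n′ = fromℕ< (ℕ.s≤s r<n′)
  ... | no  _    = zero

  prevᵣ : Fin n → Fin n
  prevᵣ zero    = fromℕ n′
  prevᵣ (suc r) = inject₁ r

  moveᵣ : ℤ → Fin n → Fin n
  moveᵣ (+ zero)      r = r
  moveᵣ (+ suc k)     r = moveᵣ (+ k) (nextᵣ r)
  moveᵣ -[1+ zero ]   r = prevᵣ r
  moveᵣ -[1+ suc k ]  r = moveᵣ -[1+ k ] (prevᵣ r)

  residue-next : ∀ x → proj₂ (next x) ≡ nextᵣ (proj₂ x)
  residue-next (q , r) with toℕ r ℕ.<? n′
  ... | yes _ = refl
  ... | no  _ = refl

  residue-prev : ∀ x → proj₂ (prev x) ≡ prevᵣ (proj₂ x)
  residue-prev (q , zero)  = refl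
  residue-prev (q , suc r) = refl

  residue-move : ∀ z x → proj₂ (move z x) ≡ moveᵣ z (proj₂ x)
  residue-move (+ zero)     x = refl
  residue-move (+ suc k)    x = trans (residue-move (+ k) (next x)) (cong (moveᵣ (+ k)) (residue-next x))
  residue-move -[1+ zero ]  x = residue-prev x
  residue-move -[1+ suc k ] x = trans (residue-move -[1+ k ] (prev x)) (cong (moveᵣ -[1+ k ]) (residue-prev x))

  block-offset : ∀ q s r → Shift (+ toℕ r - + toℕ s) (φ (q , s)) (φ (q , r))
  block-offset q s r = block-shift q q s r shift-zero (offset (+ toℕ s) (+ toℕ r) (+ n))
    where
    offset : ∀ s r n → s + (r - s) ≡ r + 0ℤ * n
    offset = solve-∀

  next-block : ∀ b s → Shift (+ n) (φ (inject₁ b , s)) (φ (suc b , s))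
  next-block b s = block-shift {c = 1ℤ} (inject₁ b) (suc b) s s (shift-exact successor) (carry (+ toℕ s) (+ n))
    where
    successor : + toℕ (inject₁ b) + 1ℤ ≡ + suc (toℕ b)
    successor = trans (cong (λ t → + t + 1ℤ) (Fin.toℕ-inject₁ b)) (ℤ.+-comm (+ toℕ b) 1ℤ)
    carry : ∀ s n → s + n ≡ s + 1ℤ * n
    carry = solve-∀

  connected-by-blocks : ∀ {D} (F G : OneFactor (m ℕ.* n) D) (s : Fin n) →
                        (∀ q r → Reach F G (φ (q , s)) (φ (q , r))) →
                        (∀ b → Reach F G (φ (inject₁ b , s)) (φ (suc b , s))) →
                        ∀ u v → Reach F G u v
  connected-by-blocks F G s within across u v = Reach-trans F G (Reach-sym F G (from-origin u)) (from-origin v)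
    where
    block-start : ∀ q → Reach F G (φ (zero , s)) (φ (q , s))
    block-start = <-weakInduction (λ q → Reach F G (φ (zero , s)) (φ (q , s))) here
                    (λ b reached → Reach-trans F G reached (across b))
    from-origin : ∀ u → Reach F G (φ (zero , s)) u
    from-origin u = subst (Reach F G _) (φ-ψ u)
                      (Reach-trans F G (block-start (proj₁ (ψ u))) (within (proj₁ (ψ u)) (proj₂ (ψ u))))

  module Walks {k : ℕ} (δ : Fin k → Fin n → ℤ) where

    mateᵣ : Fin k → Fin n → Fin n
    mateᵣ i r = moveᵣ (δ i r) r

    mateV : Fin k → V → V
    mateV i x = move (δ i (proj₂ x)) x

    walk : Fin k → Fin k → ℕ → V → V
    walk i j zero    x = x
    walk i j (suc l) x = walk j i l (mateV i x)

    walkᵣ : Fin k → Fin k → ℕ → Fin n → Fin n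
    walkᵣ i j zero    r = r
    walkᵣ i j (suc l) r = walkᵣ j i l (mateᵣ i r)

    displacement : Fin k → Fin k → ℕ → Fin n → ℤ
    displacement i j zero    r = 0ℤ
    displacement i j (suc l) r = δ i r + displacement j i l (mateᵣ i r)

    residue-mate : ∀ i x → proj₂ (mateV i x) ≡ mateᵣ i (proj₂ x)
    residue-mate i x = residue-move (δ i (proj₂ x)) x

    residue-walk : ∀ i j l x → proj₂ (walk i j l x) ≡ walkᵣ i j l (proj₂ x)
    residue-walk i j zero    x = refl
    residue-walk i j (suc l) x =
      trans (residue-walk j i l (mateV i x)) (cong (walkᵣ j i l) (residue-mate i x))

    walk-shift : ∀ i j l x → Shift (displacement i j l (proj₂ x)) (φ x) (φ (walk i j l x))
    walk-shift i j zero    x = shift-zero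
    walk-shift i j (suc l) x = shift-trans (move-shift (δ i (proj₂ x)) x)
      (subst (λ r → Shift (displacement j i l r) (φ y) (φ (walk j i l y))) (residue-mate i x)
             (walk-shift j i l y))
      where y = mateV i x

    walk-closes : ∀ i j l x → displacement i j l (proj₂ x) ≡ 0ℤ → walk i j l x ≡ x
    walk-closes i j l x closed =
      φ-injective (shift-functional (subst (λ z → Shift z (φ x) (φ (walk i j l x))) closed (walk-shift i j l x))
                                    shift-zero)

module Construction (m′ : ℕ) where

  open Congruence
  open Blocks m′ 5
  open import Data.Integer as ℤ using (ℤ; +_; -_; _+_; _-_; 0ℤ)
  open import Data.Bool using (Bool; true; false)
  open import Data.Fin.Properties as Fin using (all?; any?)
  open import Data.Vec using (Vec; _∷_; []; lookup)
  open import Data.List using (map; upTo)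
  open import Data.List.Properties using (map-cong; map-∘)
  open import Data.List.Membership.Propositional using (find)
  open import Data.List.Relation.Unary.Any as Any using (Any)
  open import Data.List.Relation.Unary.All as All using (All)
  open import Data.List.Relation.Unary.Unique.Propositional.Properties using (map⁺; map⁻)
  open import Data.List.Relation.Unary.Unique.DecPropositional (Fin._≟_ {6}) using (unique?)
  open import Data.Sum as Sum using (_⊎_)
  open import Relation.Nullary using (Dec)
  open import Relation.Nullary.Decidable using (from-yes; _×-dec_; _⊎-dec_; _→-dec_)

  N : ℕ
  N = m ℕ.* 6

  D : List ℕ
  D = 1 ∷ 2 ∷ []

  -- Row i lists the step u ↦ u + δ i r of the factor Fᵢ at the vertices u ≡ r (mod 6):
  --   F₀ = {2k, 2k+1},
  --   F₁ = {6k, 6k+2} ∪ {6k+3, 6k+4} ∪ {6k+5, 6k+7},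
  --   F₂ = {6k+1, 6k+3} ∪ {6k+2, 6k+4} ∪ {6k+5, 6k+6},
  --   F₃ = {6k+1, 6k+2} ∪ {6k+3, 6k+5} ∪ {6k+4, 6k+6}.
  steps : Vec (Vec ℤ 6) 4
  steps = (+ 1   ∷ - + 1 ∷ + 1   ∷ - + 1 ∷ + 1   ∷ - + 1 ∷ [])
        ∷ (+ 2   ∷ - + 2 ∷ - + 2 ∷ + 1   ∷ - + 1 ∷ + 2   ∷ [])
        ∷ (- + 1 ∷ + 2   ∷ + 2   ∷ - + 2 ∷ - + 2 ∷ + 1   ∷ [])
        ∷ (- + 2 ∷ + 1   ∷ - + 1 ∷ + 2   ∷ + 2   ∷ - + 2 ∷ [])
        ∷ []

  δ : Fin 4 → Fin 6 → ℤ
  δ i r = lookup (lookup steps i) r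

  open Walks δ

  steps-self-inverse : ∀ i r → displacement i i 2 r ≡ 0ℤ
  steps-self-inverse = from-yes (all? λ i → all? λ r → displacement i i 2 r ℤ.≟ 0ℤ)

  steps-in-D : ∀ i r → Any (λ d → δ i r ≡ - + d ⊎ δ i r ≡ + d) D
  steps-in-D = from-yes (all? λ i → all? λ r →
    Any.any? (λ d → (δ i r ℤ.≟ - + d) ⊎-dec (δ i r ℤ.≟ + d)) D)

  steps-onto : ∀ r → All (λ d → (∃ λ i → δ i r ≡ - + d) × (∃ λ i → δ i r ≡ + d)) D
  steps-onto = from-yes (all? λ r →
    All.all? (λ d → any? (λ i → δ i r ℤ.≟ - + d) ×-dec any? (λ i → δ i r ℤ.≟ + d)) D)

  mateᵣ-injective : ∀ r i j → mateᵣ i r ≡ mateᵣ j r → i ≡ j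
  mateᵣ-injective = from-yes (all? λ r → all? λ i → all? λ j →
    (mateᵣ i r Fin.≟ mateᵣ j r) →-dec (i Fin.≟ j))

  mateV-involutive : ∀ i x → mateV i (mateV i x) ≡ x
  mateV-involutive i x = walk-closes i i 2 x (steps-self-inverse i (proj₂ x))

  step-adjacent : ∀ i {u v} → Shift (δ i (residue u)) u v → CircAdj N D u v
  step-adjacent i {u} {v} s with find (steps-in-D i (residue u))
  ... | d , d∈D , sign = shift⇒circAdj d∈D (Sum.map retype retype sign)
    where
    retype : ∀ {z} → δ i (residue u) ≡ z → Shift z u v
    retype e = subst (λ z → Shift z u v) e s

  mate-shift : ∀ i u → Shift (δ i (residue u)) u (φ (mateV i (ψ u)))
  mate-shift i u = subst (λ w → Shift (δ i (residue u)) w (φ (mateV i (ψ u)))) (φ-ψ u) (move-shift _ (ψ u))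

  matching : Fin 4 → OneFactor N D
  matching i = record
    { mate     = λ u → φ (mateV i (ψ u))
    ; mate-adj = λ u → step-adjacent i (mate-shift i u)
    ; mate-inv = λ u → trans (cong (φ ∘ mateV i) (ψ-φ (mateV i (ψ u))))
                             (trans (cong φ (mateV-involutive i (ψ u))) (φ-ψ u))
    }

  factorisation : OneFactorisation N D
  factorisation = record { k = 4 ; factor = matching ; covers = covered ; unique = disjoint }
    where
    covered : ∀ u v → CircAdj N D u v → Σ (Fin 4) λ i → mate (matching i) u ≡ v
    covered u v adj with circAdj⇒shift adj
    ... | d , d∈D , s with All.lookup (steps-onto (residue u)) d∈D
    ...   | (i⁻ , δ≡-d) , (i⁺ , δ≡+d) = Sum.[ taken-by i⁻ δ≡-d , taken-by i⁺ δ≡+d ] s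
      where
      taken-by : ∀ i {z} → δ i (residue u) ≡ z → Shift z u v → Σ (Fin 4) λ i → mate (matching i) u ≡ v
      taken-by i δ≡z u↦v =
        i , shift-functional (subst (λ z → Shift z u (φ (mateV i (ψ u)))) δ≡z (mate-shift i u)) u↦v
    disjoint : ∀ u v i j → mate (matching i) u ≡ v → mate (matching j) u ≡ v → i ≡ j
    disjoint u v i j refl same = mateᵣ-injective (residue u) i j (begin
      mateᵣ i (residue u)    ≡⟨ residue-mate i (ψ u) ⟨
      proj₂ (mateV i (ψ u))  ≡⟨ cong proj₂ (φ-injective {mateV i (ψ u)} {mateV j (ψ u)} (sym same)) ⟩
      proj₂ (mateV j (ψ u))  ≡⟨ residue-mate j (ψ u) ⟩
      mateᵣ j (residue u)    ∎)
      where open ≡-Reasoning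

  mate-φ : ∀ i x → mate (matching i) (φ x) ≡ φ (mateV i x)
  mate-φ i x = cong (φ ∘ mateV i) (ψ-φ x)

  walk-reach : ∀ i j l x → Reach (matching i) (matching j) (φ x) (φ (walk i j l x))
  walk-reach i j zero    x = here
  walk-reach i j (suc l) x = Reach-trans (matching i) (matching j)
    (subst (Reach (matching i) (matching j) (φ x)) (mate-φ i x) (stepF here))
    (Reach-swap (walk-reach j i l (mateV i x)))

  SweepsBlock : Fin 4 → Fin 4 → Fin 6 → Set
  SweepsBlock i j s = displacement i j 6 s ≡ + 6 ×
                      (∀ (r : Fin 6) → ∃ λ (l : Fin 6) → displacement i j (toℕ l) s ≡ + toℕ r - + toℕ s)

  sweepsBlock? : ∀ i j s → Dec (SweepsBlock i j s)
  sweepsBlock? i j s = (displacement i j 6 s ℤ.≟ + 6) ×-dec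
                       all? λ r → any? λ l → displacement i j (toℕ l) s ℤ.≟ + toℕ r - + toℕ s

  sweeping-connected : ∀ i j s → SweepsBlock i j s → ∀ u v → Reach (matching i) (matching j) u v
  sweeping-connected i j s (full-block , offsets) = connected-by-blocks (matching i) (matching j) s within across
    where
    within : ∀ q r → Reach (matching i) (matching j) (φ (q , s)) (φ (q , r))
    within q r with offsets r
    ... | l , reaches-r = subst (Reach (matching i) (matching j) (φ (q , s)))
      (shift-functional (subst (λ z → Shift z (φ (q , s)) (φ (walk i j (toℕ l) (q , s)))) reaches-r
                          (walk-shift i j (toℕ l) (q , s))) (block-offset q s r))
      (walk-reach i j (toℕ l) (q , s))
    across : ∀ b → Reach (matching i) (matching j) (φ (inject₁ b , s)) (φ (suc b , s))
    across b = subst (Reach (matching i) (matching j) (φ x))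
      (shift-functional (subst (λ z → Shift z (φ x) (φ (walk i j 6 x))) full-block (walk-shift i j 6 x))
                        (next-block b s))
      (walk-reach i j 6 x)
      where x = inject₁ b , s

  ClosesHexagons : Fin 4 → Fin 4 → Set
  ClosesHexagons i j = ∀ r → displacement i j 6 r ≡ 0ℤ × Unique (map (λ l → walkᵣ i j l r) (upTo 6))

  closesHexagons? : ∀ i j → Dec (ClosesHexagons i j)
  closesHexagons? i j = all? λ r →
    (displacement i j 6 r ℤ.≟ 0ℤ) ×-dec unique? (map (λ l → walkᵣ i j l r) (upTo 6))

  hexagonal : ∀ i j → ClosesHexagons i j → HasTypeUniform (matching i) (matching j) 6
  hexagonal i j closes u = subst (λ w → ComponentSize (matching i) (matching j) w 6) (φ-ψ u)
    (hexagon (matching i) (matching j) (φ (w 1)) (φ (w 2)) (φ (w 3)) (φ (w 4)) (φ (w 5))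
      (mate-φ i x) (mate-φ j (w 1)) (mate-φ i (w 2)) (mate-φ j (w 3)) (mate-φ i (w 4))
      (trans (mate-φ j (w 5)) (cong φ (walk-closes i j 6 x (proj₁ (closes (proj₂ x))))))
      (map⁺ {f = φ} φ-injective (map⁻ {f = proj₂} {xs = map w (upTo 6)} distinct-residues)))
    where
    x = ψ u
    w : ℕ → V
    w l = walk i j l x
    distinct-residues : Unique (map proj₂ (map w (upTo 6)))
    distinct-residues = subst Unique
      (trans (sym (map-cong (λ l → residue-walk i j l x) (upTo 6))) (map-∘ {g = proj₂} {f = w} (upTo 6)))
      (proj₂ (closes (proj₂ x)))

  involves-F₀ : Fin 4 → Fin 4 → Bool
  involves-F₀ zero    _ = true
  involves-F₀ (suc _) _ = false

  F₀-pairs-sweep : ∀ j → 0 ℕ.< toℕ j → ∃ (SweepsBlock zero j)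
  F₀-pairs-sweep = from-yes (all? λ j → (0 ℕ.<? toℕ j) →-dec any? (sweepsBlock? zero j))

  other-pairs-close : ∀ i j → toℕ (suc i) ℕ.< toℕ j → ClosesHexagons (suc i) j
  other-pairs-close = from-yes (all? λ i → all? λ j →
    (toℕ (suc i) ℕ.<? toℕ j) →-dec closesHexagons? (suc i) j)

  balanced : Is2B1F-Uniform factorisation N 6
  balanced = involves-F₀ , types , refl , ℕ.s≤s ℕ.z≤n
    where
    types : ∀ i j → toℕ i ℕ.< toℕ j →
            (involves-F₀ i j ≡ true  → HasTypeUniform (matching i) (matching j) N) ×
            (involves-F₀ i j ≡ false → HasTypeUniform (matching i) (matching j) 6)
    types zero j 0<j with F₀-pairs-sweep j 0<j
    ... | s , sweeps =
      (λ _ → hamiltonian (matching zero) (matching j) (sweeping-connected zero j s sweeps)) , λ ()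
    types (suc i) j i<j = (λ ()) , λ _ → hexagonal (suc i) j (other-pairs-close i j i<j)

open import Data.Nat using (_<_; _*_)
open import Data.Nat.Divisibility using (_∣_; divides)

m*6≡2*[m*3] : ∀ m → m * 6 ≡ 2 * (m * 3)
m*6≡2*[m*3] m = trans (sym (ℕ.*-assoc m 3 2)) (ℕ.*-comm (m * 3) 2)

mainTheorem9 : (n : ℕ) → 3 < n → 3 ∣ n →
    Σ (OneFactorisation (2 * n) (1 ∷ 2 ∷ [])) λ ℱ → Is2B1F-Uniform ℱ (2 * n) 6
mainTheorem9 .(0 * 3)      ()  (divides zero refl)
mainTheorem9 .(suc m′ * 3) _   (divides (suc m′) refl) =
  subst (λ N → Σ (OneFactorisation N (1 ∷ 2 ∷ [])) λ ℱ → Is2B1F-Uniform ℱ N 6) (m*6≡2*[m*3] (suc m′))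
    (factorisation , balanced)
  where open Construction m′
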